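{- For any positive integers $m$ and $n$, $$N(C_m\times P_n)\le\sum_{k=1}^{n}\left(|\mathcal{C}_{m,k}|-|\mathcal{C}'_{m,k}|\right)\cdot(n-k+1),$$ where equality holds when $m\le 7$.
   Context: A connected set of a graph $H$ is a non-empty vertex set inducing a connected subgraph; $\mathcal{C}(H)$ is the set of connected sets of $H$ and $N(H)=|\mathcal{C}(H)|$. $K_m$ is the complete graph and $C_m$ the cycle on $m$ vertices, $P_n$ the path on $n$ vertices. The vertex set of $K_m\times P_k$ is $\{v_{i,j}:1\le i\le m,\ 1\le j\le k\}$, where $v_{i_1,j}v_{i_2,j}$ is an edge for all $i_1\neq i_2$, and $v_{i,j_1}v_{i,j_2}$ is an edge iff $|j_1-j_2|=1$. $C_m\times P_k$ has the same vertex set, with $v_{i,j}v_{i',j}$ an edge iff $i\ne i'$ and $i'-i\equiv\pm1\pmod m$, and $v_{i,j_1}v_{i,j_2}$ an edge iff $|j_1-j_2|=1$. The $j$-th column is $I_j=\{v_{i,j}:1\le i\le m\}$. $\mathcal{C}_{m,k}$ is the set of $C\in\mathcal{C}(K_m\times P_k)$ containing at least one vertex of every column, and $\mathcal{C}'_{m,k}$ is the set of $C\in\mathcal{C}(K_m\times P_k)\setminus\mathcal{C}(C_m\times P_k)$ containing at least one vertex of every column. -}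

module Defs where

open import Data.Nat using (ℕ; zero; suc; _+_; _*_; _∸_; _≤_)
open import Data.Fin using (Fin; toℕ)
open import Data.Bool using (Bool; true)
open import Data.Vec using (Vec; lookup)
open import Data.List using (List; length; map; applyUpTo)
open import Data.Nat.ListAction using (sum)
open import Data.List.Relation.Unary.Unique.Propositional using (Unique)
open import Data.List.Membership.Propositional using (_∈_)
open import Data.Product using (Σ; _×_; ∃; ∃-syntax; _,_)
open import Data.Sum using (_⊎_)
open import Relation.Nullary using (¬_)
open import Relation.Binary.PropositionalEquality using (_≡_; _≢_)
open import Function.Bundles using (_⇔_)

Vertex : ℕ → ℕ → Set
Vertex m k = Fin m × Fin k

VSet : ℕ → ℕ → Set
VSet m k = Vec (Vec Bool k) m

_∈V_ : ∀ {m k} → Vertex m k → VSet m k → Set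
(i , j) ∈V S = lookup (lookup S i) j ≡ true

PathAdj : ∀ {k} → Fin k → Fin k → Set
PathAdj a b = suc (toℕ a) ≡ toℕ b ⊎ suc (toℕ b) ≡ toℕ a

CycSucc : ∀ {m} → Fin m → Fin m → Set
CycSucc {m} a b = suc (toℕ a) ≡ toℕ b ⊎ (suc (toℕ a) ≡ m × toℕ b ≡ 0)

KAdj : ∀ {m k} → Vertex m k → Vertex m k → Set
KAdj (i , j) (i' , j') = (j ≡ j' × i ≢ i') ⊎ (i ≡ i' × PathAdj j j')

CAdj : ∀ {m k} → Vertex m k → Vertex m k → Set
CAdj (i , j) (i' , j') =
  (j ≡ j' × i ≢ i' × (CycSucc i i' ⊎ CycSucc i' i)) ⊎ (i ≡ i' × PathAdj j j')

data Reach {m k} (Adj : Vertex m k → Vertex m k → Set) (S : VSet m k)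
     : Vertex m k → Vertex m k → Set where
  here : ∀ {u} → u ∈V S → Reach Adj S u u
  step : ∀ {u w v} → u ∈V S → Adj u w → Reach Adj S w v → Reach Adj S u v

Connected : ∀ {m k} → (Vertex m k → Vertex m k → Set) → VSet m k → Set
Connected Adj S =
  (∃[ u ] u ∈V S) × (∀ u v → u ∈V S → v ∈V S → Reach Adj S u v)

MeetsAllColumns : ∀ {m k} → VSet m k → Set
MeetsAllColumns {m} {k} S = ∀ (j : Fin k) → ∃[ i ] ((i , j) ∈V S)

InCmk : ∀ {m k} → VSet m k → Set
InCmk S = Connected KAdj S × MeetsAllColumns S

InC'mk : ∀ {m k} → VSet m k → Set
InC'mk S = Connected KAdj S × ¬ Connected CAdj S × MeetsAllColumns S

HasCard : {X : Set} → (X → Set) → ℕ → Set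
HasCard {X} P N =
  Σ (List X) λ L → Unique L × (∀ x → (x ∈ L) ⇔ P x) × length L ≡ N

Σ1to : ℕ → (ℕ → ℕ) → ℕ
Σ1to n f = sum (map f (applyUpTo suc n))

-- A connected set of C_m × P_n occupies an interval of columns a, …, a + k − 1, since a walk changes
-- column by at most one. Deleting the empty columns turns it into a connected set of C_m × P_k meeting
-- every column, and conversely each such set can be placed at any of the n − k + 1 offsets a. The
-- connected sets of C_m × P_k meeting every column are exactly 𝒞_{m,k} ∖ 𝒞'_{m,k}, of size
-- |𝒞_{m,k}| − |𝒞'_{m,k}| because 𝒞'_{m,k} ⊆ 𝒞_{m,k}; summing over k and a counts N(C_m × P_n) exactly.

module Submission where

open import Defs
open import Data.Nat using (ℕ; zero; suc; _+_; _*_; _∸_; _≤_; _<_; z≤n; s≤s; s≤s⁻¹; _<?_; _≤?_)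
open import Data.Nat.Properties
open import Data.Nat.ListAction using (sum)
open import Data.Bool using (Bool; true; false)
open import Data.Bool.Properties using (¬-not) renaming (_≟_ to _≟ᴮ_)
open import Data.Fin using (Fin; toℕ; fromℕ<; inject≤; _↑ʳ_)
open import Data.Fin.Properties using (toℕ-fromℕ<; toℕ<n; toℕ-inject≤; toℕ-↑ʳ; toℕ-injective; any?)
open import Data.Vec as Vec using (Vec; []; _∷_; lookup)
open import Data.Vec.Properties using (lookup-map; tabulate∘lookup; tabulate-cong; ≡-dec)
open import Data.List using (List; []; _∷_; _++_; length; map; filter; applyUpTo; upTo)
open import Data.List.Properties using (length-++; length-map; length-upTo)
open import Data.List.Relation.Unary.Unique.Propositional using (Unique; []; _∷_)
open import Data.List.Relation.Unary.Unique.Propositional.Properties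
  using (++⁺; map⁺; filter⁺; applyUpTo⁺₁; upTo⁺; Unique[x∷xs]⇒x∉xs)
open import Data.List.Relation.Unary.Any using (here; there)
open import Data.List.Membership.Propositional using (_∈_)
open import Data.List.Membership.Propositional.Properties
  using (++-∈⇔; ∈-map⁺; ∈-map⁻; ∈-filter⁺; ∈-filter⁻; ∈-applyUpTo⁺; ∈-applyUpTo⁻; ∈-upTo⁺; ∈-upTo⁻)
import Data.List.Membership.DecPropositional as DecMembership
open import Data.List.Membership.Propositional.Properties.WithK using (unique∧set⇒bag)
open import Data.List.Relation.Binary.BagAndSetEquality using (∼bag⇒↭)
open import Data.List.Relation.Binary.Permutation.Propositional.Properties using (↭-length)
open import Data.Product using (_×_; ∃-syntax; _,_; proj₁; proj₂)
open import Data.Product.Function.NonDependent.Propositional using (_×-⇔_)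
open import Data.Sum as Sum using (_⊎_; inj₁; inj₂)
open import Data.Sum.Function.Propositional using (_⊎-⇔_)
open import Data.Empty using (⊥; ⊥-elim)
open import Function.Base using (_∘_)
open import Function.Bundles using (_⇔_; mk⇔; Equivalence)
open import Function.Definitions using (Injective)
import Function.Properties.Equivalence as ⇔
open import Relation.Nullary using (¬_; Dec; yes; no; contradiction)
open import Relation.Nullary.Decidable as Dec using (_×-dec_)
open import Relation.Unary using (Decidable)
open import Relation.Binary.Definitions using (DecidableEquality)
open import Relation.Binary.PropositionalEquality
  using (_≡_; refl; sym; trans; cong; cong₂; subst; module ≡-Reasoning)

open Equivalence using (to; from)

-- Cardinalities of enumerated predicates

module _ {X : Set} where

  HasCard-unique : {P : X → Set} {a b : ℕ} → HasCard P a → HasCard P b → a ≡ b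
  HasCard-unique (L , uL , eL , refl) (M , uM , eM , refl) =
    ↭-length (∼bag⇒↭ (unique∧set⇒bag uL uM (λ {x} → ⇔.trans (eL x) (⇔.sym (eM x)))))

  HasCard-cong : {P Q : X → Set} {c : ℕ} → (∀ x → P x ⇔ Q x) → HasCard P c → HasCard Q c
  HasCard-cong P⇔Q (L , uL , eL , lL) = L , uL , (λ x → ⇔.trans (eL x) (P⇔Q x)) , lL

  HasCard⇒Decidable : {P : X → Set} {c : ℕ} → DecidableEquality X → HasCard P c → Decidable P
  HasCard⇒Decidable _≟_ (L , _ , eL , _) x = Dec.map (eL x) (x ∈? L)
    where open DecMembership _≟_ using (_∈?_)

  HasCard-⊎ : {P Q : X → Set} {a b : ℕ} → (∀ {x} → P x → Q x → ⊥) →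
    HasCard P a → HasCard Q b → HasCard (λ x → P x ⊎ Q x) (a + b)
  HasCard-⊎ P∩Q=∅ (L , uL , eL , refl) (M , uM , eM , refl) =
    L ++ M ,
    ++⁺ uL uM (λ (x∈L , x∈M) → P∩Q=∅ (to (eL _) x∈L) (to (eM _) x∈M)) ,
    (λ x → ⇔.trans ++-∈⇔ (eL x ⊎-⇔ eM x)) ,
    length-++ L

  HasCard-∖ : {P Q : X → Set} {a b : ℕ} → DecidableEquality X → (∀ {x} → Q x → P x) →
    HasCard P a → HasCard Q b → HasCard (λ x → P x × ¬ Q x) (a ∸ b)
  HasCard-∖ {P} {Q} {a} {b} _≟_ Q⊆P hP@(L , uL , eL , _) hQ@(M , _ , eM , _) =
    subst (HasCard P∖Q) b+d∸b≡a∸b hP∖Q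
    where
    open DecMembership _≟_ using (_∉?_)
    P∖Q : X → Set
    P∖Q x = P x × ¬ Q x
    D = filter (_∉? M) L
    hP∖Q : HasCard P∖Q (length D)
    hP∖Q = D , filter⁺ (_∉? M) uL ,
      (λ x → mk⇔ (λ x∈D → let (x∈L , x∉M) = ∈-filter⁻ (_∉? M) x∈D
                           in to (eL x) x∈L , x∉M ∘ from (eM x))
                 (λ (Px , ¬Qx) → ∈-filter⁺ (_∉? M) (from (eL x) Px) (¬Qx ∘ to (eM x)))) ,
      refl
    Q⊎P∖Q⇔P : ∀ x → (Q x ⊎ P∖Q x) ⇔ P x
    Q⊎P∖Q⇔P x = mk⇔ (λ { (inj₁ Qx) → Q⊆P Qx ; (inj₂ (Px , _)) → Px })
      (λ Px → Sum.map₂ (Px ,_) (Dec.toSum (HasCard⇒Decidable _≟_ hQ x)))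
    a≡b+d : a ≡ b + length D
    a≡b+d = HasCard-unique hP (HasCard-cong Q⊎P∖Q⇔P (HasCard-⊎ (λ Qx (_ , ¬Qx) → ¬Qx Qx) hQ hP∖Q))
    b+d∸b≡a∸b : length D ≡ a ∸ b
    b+d∸b≡a∸b = trans (sym (m+n∸m≡n b (length D))) (cong (_∸ b) (sym a≡b+d))

  HasCard-image : {Y : Set} {P : X → Set} {c : ℕ} (g : X → Y) → Injective _≡_ _≡_ g →
    HasCard P c → HasCard (λ y → ∃[ x ] P x × g x ≡ y) c
  HasCard-image g g-inj (L , uL , eL , refl) =
    map g L , map⁺ g-inj uL ,
    (λ y → mk⇔ (λ y∈gL → let (x , x∈L , y≡gx) = ∈-map⁻ g y∈gL in x , to (eL x) x∈L , sym y≡gx)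
               (λ { (x , Px , refl) → ∈-map⁺ g (from (eL x) Px) })) ,
    length-map g L

module _ {X I : Set} {P : I → X → Set} (f : I → ℕ) where

  HasCard-⋃ : (is : List I) → Unique is →
    (∀ {i j x} → i ∈ is → j ∈ is → P i x → P j x → i ≡ j) →
    (∀ {i} → i ∈ is → HasCard (P i) (f i)) →
    HasCard (λ x → ∃[ i ] i ∈ is × P i x) (sum (map f is))
  HasCard-⋃ [] _ _ _ = [] , [] , (λ x → mk⇔ (λ ()) (λ ())) , refl
  HasCard-⋃ (i ∷ is) u@(_ ∷ uis) disjoint hP =
    HasCard-cong ⋃-∷ (HasCard-⊎ Pi∩⋃=∅ (hP (here refl))
      (HasCard-⋃ is uis (λ i∈ j∈ → disjoint (there i∈) (there j∈)) (hP ∘ there)))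
    where
    Pi∩⋃=∅ : ∀ {x} → P i x → ∃[ j ] j ∈ is × P j x → ⊥
    Pi∩⋃=∅ Pix (j , j∈is , Pjx) with disjoint (here refl) (there j∈is) Pix Pjx
    ... | refl = Unique[x∷xs]⇒x∉xs u j∈is
    ⋃-∷ : ∀ x → (P i x ⊎ ∃[ j ] j ∈ is × P j x) ⇔ (∃[ j ] j ∈ i ∷ is × P j x)
    ⋃-∷ x = mk⇔ (λ { (inj₁ Pix) → i , here refl , Pix ; (inj₂ (j , j∈ , Pjx)) → j , there j∈ , Pjx })
                 (λ { (j , here refl , Pjx) → inj₁ Pjx ; (j , there j∈ , Pjx) → inj₂ (j , j∈ , Pjx) })

sum-map-const : {A : Set} (c : ℕ) (xs : List A) → sum (map (λ _ → c) xs) ≡ length xs * c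
sum-map-const c [] = refl
sum-map-const c (_ ∷ xs) = cong (c +_) (sum-map-const c xs)

-- Intervals of ℕ

Window : ℕ → ℕ → ℕ → Set
Window a k t = a ≤ t × t < a + k

Convex : (ℕ → Set) → Set
Convex P = ∀ {s t u} → P s → P u → s ≤ t → t ≤ u → P t

least : {P : ℕ → Set} → Decidable P → ∀ {t} → P t → ∃[ a ] P a × (∀ {s} → s < a → ¬ P s)
least P? {zero} P0 = zero , P0 , λ ()
least P? {suc t} Pt with P? zero
... | yes P0 = zero , P0 , λ ()
... | no ¬P0 =
  let (a , Psa , below) = least (P? ∘ suc) Pt
  in suc a , Psa , λ { {zero} _ → ¬P0 ; {suc s} (s≤s s<a) → below s<a }

greatest : {P : ℕ → Set} → Decidable P → ∀ {n} → (∀ {t} → P t → t < n) →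
  ∀ {t} → P t → ∃[ b ] P b × (∀ {s} → b < s → ¬ P s)
greatest P? {zero} bounded Pt = contradiction (bounded Pt) λ ()
greatest {P} P? {suc n} bounded Pt with P? n
... | yes Pn = n , Pn , λ n<s Ps → <⇒≱ (bounded Ps) n<s
... | no ¬Pn = greatest P? bounded′ Pt
  where
  bounded′ : ∀ {t} → P t → t < n
  bounded′ {t} Pt with m≤n⇒m<n∨m≡n (s≤s⁻¹ (bounded Pt))
  ... | inj₁ t<n = t<n
  ... | inj₂ refl = contradiction Pt ¬Pn

Window-⊆⇒≥ : ∀ {a b k l} → 1 ≤ k → (∀ {t} → Window a k t → Window b l t) → b ≤ a
Window-⊆⇒≥ {a} 1≤k W⊆W = proj₁ (W⊆W (≤-refl , m<m+n a 1≤k))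

Window-⊆⇒≤ : ∀ {a k l} → (∀ {t} → Window a k t → Window a l t) → k ≤ l
Window-⊆⇒≤ {a} {l = l} W⊆W = ≮⇒≥ λ l<k → n≮n (a + l) (proj₂ (W⊆W (m≤m+n a l , +-monoʳ-< a l<k)))

Window-injective : ∀ {a b k l} → 1 ≤ k → 1 ≤ l → (∀ t → Window a k t ⇔ Window b l t) → a ≡ b × k ≡ l
Window-injective 1≤k 1≤l W⇔W
  with ≤-antisym (Window-⊆⇒≥ 1≤l (from (W⇔W _))) (Window-⊆⇒≥ 1≤k (to (W⇔W _)))
... | refl = refl , ≤-antisym (Window-⊆⇒≤ (to (W⇔W _))) (Window-⊆⇒≤ (from (W⇔W _)))

convex⇒Window : {P : ℕ → Set} → Decidable P → ∀ {n} → (∀ {t} → P t → t < n) → Convex P →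
  ∀ {t} → P t → ∃[ a ] ∃[ k ] 1 ≤ k × a + k ≤ n × (∀ t → P t ⇔ Window a k t)
convex⇒Window {P} P? {n} bounded convex Pt = window (least P? Pt) (greatest P? bounded Pt)
  where
  window : ∃[ a ] P a × (∀ {s} → s < a → ¬ P s) → ∃[ b ] P b × (∀ {s} → b < s → ¬ P s) →
    ∃[ a ] ∃[ k ] 1 ≤ k × a + k ≤ n × (∀ t → P t ⇔ Window a k t)
  window (a , Pa , below) (b , Pb , above) =
    a , suc (b ∸ a) , s≤s z≤n , subst (_≤ n) (sym a+k≡1+b) (bounded Pb) ,
    λ t → mk⇔ (λ Pt → a≤ Pt , subst (t <_) (sym a+k≡1+b) (s≤s (≤b Pt)))
              (λ (a≤t , t<a+k) → convex Pa Pb a≤t (s≤s⁻¹ (subst (t <_) a+k≡1+b t<a+k)))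
    where
    a≤ : ∀ {t} → P t → a ≤ t
    a≤ Pt = ≮⇒≥ λ t<a → below t<a Pt
    ≤b : ∀ {t} → P t → t ≤ b
    ≤b Pt = ≮⇒≥ λ b<t → above b<t Pt
    a+k≡1+b : a + suc (b ∸ a) ≡ suc b
    a+k≡1+b = trans (+-suc a (b ∸ a)) (cong suc (m+[n∸m]≡n (a≤ Pb)))

-- Columns are indexed by ℕ so that translating a grid is arithmetic; out-of-range columns read as empty.
infixl 9 _!_

_!_ : ∀ {k} → Vec Bool k → ℕ → Bool
[] ! _ = false
(b ∷ v) ! zero = b
(b ∷ v) ! suc t = v ! t

!-toℕ : ∀ {k} (v : Vec Bool k) (j : Fin k) → v ! toℕ j ≡ lookup v j
!-toℕ (b ∷ v) Fin.zero = refl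
!-toℕ (b ∷ v) (Fin.suc j) = !-toℕ v j

!-≥ : ∀ {k} (v : Vec Bool k) {t} → k ≤ t → v ! t ≡ false
!-≥ [] _ = refl
!-≥ (b ∷ v) {suc t} (s≤s k≤t) = !-≥ v k≤t

!-ext : ∀ {k} (v w : Vec Bool k) → (∀ {t} → t < k → v ! t ≡ w ! t) → v ≡ w
!-ext [] [] _ = refl
!-ext (b ∷ v) (c ∷ w) v≐w = cong₂ _∷_ (v≐w (s≤s z≤n)) (!-ext v w (v≐w ∘ s≤s))

tabulateℕ : (n : ℕ) → (ℕ → Bool) → Vec Bool n
tabulateℕ zero g = []
tabulateℕ (suc n) g = g 0 ∷ tabulateℕ n (g ∘ suc)

!-tabulateℕ : ∀ n (g : ℕ → Bool) {t} → t < n → tabulateℕ n g ! t ≡ g t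
!-tabulateℕ (suc n) g {zero} _ = refl
!-tabulateℕ (suc n) g {suc t} (s≤s t<n) = !-tabulateℕ n (g ∘ suc) t<n

delay : ℕ → (ℕ → Bool) → ℕ → Bool
delay zero g t = g t
delay (suc a) g zero = false
delay (suc a) g (suc t) = delay a g t

delay-+ : ∀ a g t → delay a g (a + t) ≡ g t
delay-+ zero g t = refl
delay-+ (suc a) g t = delay-+ a g t

delay-< : ∀ a g {t} → t < a → delay a g t ≡ false
delay-< (suc a) g {zero} _ = refl
delay-< (suc a) g {suc t} (s≤s t<a) = delay-< a g t<a

VSet-≟ : ∀ {m k} → DecidableEquality (VSet m k)
VSet-≟ = ≡-dec (≡-dec _≟ᴮ_)

cell : ∀ {m k} → VSet m k → Fin m → ℕ → Bool
cell S i t = lookup S i ! t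

VSet-ext : ∀ {m k} (S S′ : VSet m k) → (∀ i {t} → t < k → cell S i t ≡ cell S′ i t) → S ≡ S′
VSet-ext S S′ S≐S′ =
  trans (sym (tabulate∘lookup S))
        (trans (tabulate-cong λ i → !-ext _ _ (S≐S′ i)) (tabulate∘lookup S′))

cell-≥ : ∀ {m k} (S : VSet m k) i {t} → k ≤ t → cell S i t ≡ false
cell-≥ S i = !-≥ (lookup S i)

-- The k columns of x become the columns a, …, a + k − 1 (truncated unless a + k ≤ n).
pad : ∀ {m k} (a n : ℕ) → VSet m k → VSet m n
pad a n = Vec.map λ v → tabulateℕ n (delay a (v !_))

restrict : ∀ {m n} (a k : ℕ) → VSet m n → VSet m k
restrict a k = Vec.map λ v → tabulateℕ k λ t → v ! (a + t)

module _ {m k : ℕ} {a n : ℕ} (x : VSet m k) (i : Fin m) where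

  cell-pad-< : ∀ {t} → t < a → cell (pad a n x) i t ≡ false
  cell-pad-< {t} t<a rewrite lookup-map i (λ v → tabulateℕ n (delay a (v !_))) x with t <? n
  ... | yes t<n = trans (!-tabulateℕ n _ t<n) (delay-< a _ t<a)
  ... | no t≮n = !-≥ (tabulateℕ n _) (≮⇒≥ t≮n)

  cell-pad-+ : a + k ≤ n → ∀ t → cell (pad a n x) i (a + t) ≡ cell x i t
  cell-pad-+ a+k≤n t rewrite lookup-map i (λ v → tabulateℕ n (delay a (v !_))) x with a + t <? n
  ... | yes a+t<n = trans (!-tabulateℕ n _ a+t<n) (delay-+ a _ t)
  ... | no a+t≮n = trans (!-≥ (tabulateℕ n _) (≮⇒≥ a+t≮n))
                         (sym (cell-≥ x i (+-cancelˡ-≤ a k t (≤-trans a+k≤n (≮⇒≥ a+t≮n)))))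

cell-restrict : ∀ {m n} a k (S : VSet m n) i {t} → t < k → cell (restrict a k S) i t ≡ cell S i (a + t)
cell-restrict a k S i {t} t<k rewrite lookup-map i (λ v → tabulateℕ k λ t → v ! (a + t)) S =
  !-tabulateℕ k _ t<k

restrict-pad : ∀ {m k a n} (x : VSet m k) → a + k ≤ n → restrict a k (pad a n x) ≡ x
restrict-pad {a = a} x a+k≤n = VSet-ext _ x λ i {t} t<k →
  trans (cell-restrict a _ (pad a _ x) i t<k) (cell-pad-+ x i a+k≤n t)

pad-injective : ∀ {m k a n} → a + k ≤ n → Injective _≡_ _≡_ (pad {m} {k} a n)
pad-injective {a = a} a+k≤n {x} {y} px≡py =
  trans (sym (restrict-pad x a+k≤n)) (trans (cong (restrict a _) px≡py) (restrict-pad y a+k≤n))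

Occupied : ∀ {m k} → VSet m k → ℕ → Set
Occupied S t = ∃[ i ] cell S i t ≡ true

occupied? : ∀ {m k} (S : VSet m k) → Decidable (Occupied S)
occupied? S t = any? λ i → cell S i t ≟ᴮ true

Occupied-< : ∀ {m k} (S : VSet m k) {t} → Occupied S t → t < k
Occupied-< S (i , Sit) = ≰⇒> λ k≤t → contradiction (trans (sym Sit) (cell-≥ S i k≤t)) λ ()

Spans : ∀ {m n} → VSet m n → ℕ → ℕ → Set
Spans S a k = ∀ t → Occupied S t ⇔ Window a k t

Spans-injective : ∀ {m n} (S : VSet m n) {a b k l} → 1 ≤ k → 1 ≤ l →
  Spans S a k → Spans S b l → a ≡ b × k ≡ l
Spans-injective S 1≤k 1≤l spans spans′ =
  Window-injective 1≤k 1≤l λ t → ⇔.trans (⇔.sym (spans t)) (spans′ t)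

∈V⇔ : ∀ {m k} (S : VSet m k) i j → (i , j) ∈V S ⇔ cell S i (toℕ j) ≡ true
∈V⇔ S i j = mk⇔ (trans (!-toℕ (lookup S i) j)) (trans (sym (!-toℕ (lookup S i) j)))

MeetsAllColumns⇔ : ∀ {m k} (S : VSet m k) → MeetsAllColumns S ⇔ (∀ {t} → t < k → Occupied S t)
MeetsAllColumns⇔ S = mk⇔ into onto
  where
  into : MeetsAllColumns S → ∀ {t} → t < _ → Occupied S t
  into meets {t} t<k with meets (fromℕ< t<k)
  ... | i , Sij = i , subst (λ t → cell S i t ≡ true) (toℕ-fromℕ< t<k) (to (∈V⇔ S i _) Sij)
  onto : (∀ {t} → t < _ → Occupied S t) → MeetsAllColumns S
  onto occupied j with occupied (toℕ<n j)
  ... | i , Sij = i , from (∈V⇔ S i j) Sij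

cell-outside : ∀ {m k} (S : VSet m k) {P : ℕ → Set} → (∀ {t} → Occupied S t → P t) →
  ∀ i {t} → ¬ P t → cell S i t ≡ false
cell-outside S occupied⇒P i ¬Pt = ¬-not λ Sit → ¬Pt (occupied⇒P (i , Sit))

module _ {m k a n : ℕ} (x : VSet m k) (a+k≤n : a + k ≤ n) where

  Occupied-pad⇒Window : ∀ {t} → Occupied (pad a n x) t → Window a k t
  Occupied-pad⇒Window {t} (i , Pit) with a ≤? t
  ... | no a≰t = contradiction (trans (sym Pit) (cell-pad-< x i (≰⇒> a≰t))) λ ()
  ... | yes a≤t with m≤n⇒∃[o]m+o≡n a≤t
  ... | u , refl = m≤m+n a u , +-monoʳ-< a (Occupied-< x (i , trans (sym (cell-pad-+ x i a+k≤n u)) Pit))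

  Spans-pad : (∀ {t} → t < k → Occupied x t) → Spans (pad a n x) a k
  Spans-pad meets t = mk⇔ Occupied-pad⇒Window onto
    where
    onto : Window a k t → Occupied (pad a n x) t
    onto (a≤t , t<a+k) with m≤n⇒∃[o]m+o≡n a≤t
    ... | u , refl with meets (+-cancelˡ-< a u k t<a+k)
    ... | i , xiu = i , trans (cell-pad-+ x i a+k≤n u) xiu

pad-restrict : ∀ {m n a k} (S : VSet m n) → a + k ≤ n → Spans S a k → pad a n (restrict a k S) ≡ S
pad-restrict {a = a} {k} S a+k≤n spans = VSet-ext _ S λ i {t} _ → cells i t
  where
  R = restrict a k S
  cells : ∀ i t → cell (pad a _ R) i t ≡ cell S i t
  cells i t with a ≤? t ×-dec t <? a + k
  ... | no ¬W = trans (cell-outside (pad a _ R) (Occupied-pad⇒Window R a+k≤n) i ¬W)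
                      (sym (cell-outside S (to (spans _)) i ¬W))
  ... | yes (a≤t , t<a+k) with m≤n⇒∃[o]m+o≡n a≤t
  ... | u , refl = trans (cell-pad-+ R i a+k≤n u) (cell-restrict a k S i (+-cancelˡ-< a u k t<a+k))

-- Connectivity

Reach-start : ∀ {m k} {A : Vertex m k → Vertex m k → Set} {S u v} → Reach A S u v → u ∈V S
Reach-start (here u∈S) = u∈S
Reach-start (step u∈S _ _) = u∈S

Reach-mono : ∀ {m k} {A B : Vertex m k → Vertex m k → Set} {S u v} →
  (∀ {x y} → A x y → B x y) → Reach A S u v → Reach B S u v
Reach-mono A⇒B (here u∈S) = here u∈S
Reach-mono A⇒B (step u∈S adj r) = step u∈S (A⇒B adj) (Reach-mono A⇒B r)

CAdj⇒KAdj : ∀ {m k} {u v : Vertex m k} → CAdj u v → KAdj u v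
CAdj⇒KAdj (inj₁ (j≡j′ , i≢i′ , _)) = inj₁ (j≡j′ , i≢i′)
CAdj⇒KAdj (inj₂ path) = inj₂ path

Connected-CAdj⇒KAdj : ∀ {m k} {S : VSet m k} → Connected CAdj S → Connected KAdj S
Connected-CAdj⇒KAdj (nonempty , reach) =
  nonempty , λ u v u∈S v∈S → Reach-mono CAdj⇒KAdj (reach u v u∈S v∈S)

record InducedIsomorphism {m k m′ k′}
    (A : Vertex m k → Vertex m k → Set) (B : Vertex m′ k′ → Vertex m′ k′ → Set)
    (S : VSet m k) (T : VSet m′ k′) : Set where
  field
    f : Vertex m k → Vertex m′ k′
    f-injective : Injective _≡_ _≡_ f
    f-∈ : ∀ {u} → u ∈V S ⇔ f u ∈V T
    f-onto : ∀ {w} → w ∈V T → ∃[ u ] f u ≡ w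
    f-adj : ∀ {u v} → A u v ⇔ B (f u) (f v)

module _ {m k m′ k′} {A : Vertex m k → Vertex m k → Set} {B : Vertex m′ k′ → Vertex m′ k′ → Set}
         {S : VSet m k} {T : VSet m′ k′} (iso : InducedIsomorphism A B S T) where

  open InducedIsomorphism iso

  private
    reach⁺ : ∀ {u v} → Reach A S u v → Reach B T (f u) (f v)
    reach⁺ (here u∈S) = here (to f-∈ u∈S)
    reach⁺ (step u∈S adj r) = step (to f-∈ u∈S) (to f-adj adj) (reach⁺ r)

    reach⁻ : ∀ {w w′} → Reach B T w w′ → ∀ {u v} → f u ≡ w → f v ≡ w′ → Reach A S u v
    reach⁻ (here w∈T) refl fv≡fu with f-injective fv≡fu
    ... | refl = here (from f-∈ w∈T)
    reach⁻ (step w∈T adj r) refl fv≡w′ with f-onto (Reach-start r)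
    ... | _ , refl = step (from f-∈ w∈T) (from f-adj adj) (reach⁻ r refl fv≡w′)

  Connected-iso : Connected A S ⇔ Connected B T
  Connected-iso = mk⇔ into onto
    where
    into : Connected A S → Connected B T
    into ((u , u∈S) , reach) =
      (f u , to f-∈ u∈S) , λ w w′ w∈T w′∈T → go (f-onto w∈T) (f-onto w′∈T) w∈T w′∈T
      where
      go : ∀ {w w′} → ∃[ u ] f u ≡ w → ∃[ v ] f v ≡ w′ → w ∈V T → w′ ∈V T → Reach B T w w′
      go (u , refl) (v , refl) fu∈T fv∈T = reach⁺ (reach u v (from f-∈ fu∈T) (from f-∈ fv∈T))
    onto : Connected B T → Connected A S
    onto ((w , w∈T) , reach) with f-onto w∈T
    ... | u , refl = (u , from f-∈ w∈T) ,
      λ u v u∈S v∈S → reach⁻ (reach (f u) (f v) (to f-∈ u∈S) (to f-∈ v∈S)) refl refl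

module _ {m k : ℕ} (a : ℕ) {n : ℕ} (a+k≤n : a + k ≤ n) where

  shiftCol : Fin k → Fin n
  shiftCol j = inject≤ (a ↑ʳ j) a+k≤n

  toℕ-shiftCol : ∀ j → toℕ (shiftCol j) ≡ a + toℕ j
  toℕ-shiftCol j = trans (toℕ-inject≤ (a ↑ʳ j) a+k≤n) (toℕ-↑ʳ a j)

  shiftCol-injective : Injective _≡_ _≡_ shiftCol
  shiftCol-injective {j} {j′} eq = toℕ-injective (+-cancelˡ-≡ a _ _
    (trans (sym (toℕ-shiftCol j)) (trans (cong toℕ eq) (toℕ-shiftCol j′))))

  PathAdj-shiftCol : ∀ {j j′} → PathAdj j j′ ⇔ PathAdj (shiftCol j) (shiftCol j′)
  PathAdj-shiftCol {j} {j′} = suc-shift j j′ ⊎-⇔ suc-shift j′ j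
    where
    suc-shift : ∀ j j′ → (suc (toℕ j) ≡ toℕ j′) ⇔ (suc (toℕ (shiftCol j)) ≡ toℕ (shiftCol j′))
    suc-shift j j′ rewrite toℕ-shiftCol j | toℕ-shiftCol j′ =
      mk⇔ (λ eq → trans (sym (+-suc a _)) (cong (a +_) eq))
          (λ eq → +-cancelˡ-≡ a _ _ (trans (+-suc a _) eq))

  pad-isomorphism : (x : VSet m k) → InducedIsomorphism CAdj CAdj x (pad a n x)
  pad-isomorphism x = record
    { f = shift
    ; f-injective = λ eq → cong₂ _,_ (cong proj₁ eq) (shiftCol-injective (cong proj₂ eq))
    ; f-∈ = λ { {i , j} →
        ⇔.trans (∈V⇔ x i j) (⇔.trans (true-resp (sym (cell-pad-shift i j))) (⇔.sym (∈V⇔ P i _))) }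
    ; f-onto = onto
    ; f-adj = λ { {_ , _} {_ , _} →
        (mk⇔ (cong shiftCol) shiftCol-injective ×-⇔ ⇔.refl) ⊎-⇔ (⇔.refl ×-⇔ PathAdj-shiftCol) }
    }
    where
    P = pad a n x
    shift : Vertex m k → Vertex m n
    shift (i , j) = i , shiftCol j
    true-resp : ∀ {b b′ : Bool} → b ≡ b′ → (b ≡ true) ⇔ (b′ ≡ true)
    true-resp b≡b′ = mk⇔ (trans (sym b≡b′)) (trans b≡b′)
    cell-pad-shift : ∀ i j → cell P i (toℕ (shiftCol j)) ≡ cell x i (toℕ j)
    cell-pad-shift i j = trans (cong (cell P i) (toℕ-shiftCol j)) (cell-pad-+ x i a+k≤n (toℕ j))
    onto : ∀ {w} → w ∈V P → ∃[ u ] shift u ≡ w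
    onto {i , J} J∈P with Occupied-pad⇒Window x a+k≤n (i , to (∈V⇔ P i J) J∈P)
    ... | a≤J , J<a+k with m≤n⇒∃[o]m+o≡n a≤J
    ... | u , a+u≡J = (i , fromℕ< u<k) , cong (i ,_) (toℕ-injective
          (trans (toℕ-shiftCol _) (trans (cong (a +_) (toℕ-fromℕ< u<k)) a+u≡J)))
      where
      u<k : u < k
      u<k = +-cancelˡ-< a u k (subst (_< a + k) (sym a+u≡J) J<a+k)

col : ∀ {m k} → Vertex m k → ℕ
col (_ , j) = toℕ j

CAdj-col : ∀ {m k} {u w : Vertex m k} → CAdj u w → col w ≤ suc (col u)
CAdj-col (inj₁ (refl , _)) = n≤1+n _
CAdj-col (inj₂ (refl , inj₁ 1+j≡j′)) = ≤-reflexive (sym 1+j≡j′)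
CAdj-col (inj₂ (refl , inj₂ 1+j′≡j)) = m≤n⇒m≤1+n (subst (_ ≤_) 1+j′≡j (n≤1+n _))

∈V⇒Occupied : ∀ {m k} (S : VSet m k) {u} → u ∈V S → Occupied S (col u)
∈V⇒Occupied S {i , j} u∈S = i , to (∈V⇔ S i j) u∈S

Reach-occupies : ∀ {m k} {S : VSet m k} {u v t} → Reach CAdj S u v →
  col u ≤ t → t ≤ col v → Occupied S t
Reach-occupies {S = S} (here u∈S) u≤t t≤u with ≤-antisym u≤t t≤u
... | refl = ∈V⇒Occupied S u∈S
Reach-occupies {S = S} (step u∈S adj r) u≤t t≤v with m≤n⇒m<n∨m≡n u≤t
... | inj₁ u<t = Reach-occupies r (≤-trans (CAdj-col adj) u<t) t≤v
... | inj₂ refl = ∈V⇒Occupied S u∈S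

Occupied⇒∈V : ∀ {m k} (S : VSet m k) {t} → Occupied S t → ∃[ u ] u ∈V S × col u ≡ t
Occupied⇒∈V S occ@(i , Sit) =
  (i , fromℕ< t<k) , from (∈V⇔ S i _) (trans (cong (cell S i) (toℕ-fromℕ< t<k)) Sit) , toℕ-fromℕ< t<k
  where
  t<k = Occupied-< S occ

Connected⇒Convex : ∀ {m k} {S : VSet m k} → Connected CAdj S → Convex (Occupied S)
Connected⇒Convex {S = S} (_ , reach) {s} {t} {u} Ss Su s≤t t≤u
  with Occupied⇒∈V S Ss | Occupied⇒∈V S Su
... | v , v∈S , refl | w , w∈S , refl = Reach-occupies (reach v w v∈S w∈S) s≤t t≤u

Connected⇒Spans : ∀ {m n} {S : VSet m n} → Connected CAdj S →
  ∃[ a ] ∃[ k ] 1 ≤ k × a + k ≤ n × Spans S a k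
Connected⇒Spans {S = S} cS@((u , u∈S) , _) =
  convex⇒Window (occupied? S) (Occupied-< S) (Connected⇒Convex cS) (∈V⇒Occupied S u∈S)

-- Read off the enumeration of connected sets of the wider grid, rather than by a search for walks.
Connected-decidable : ∀ {m k n N} → k ≤ n → HasCard {VSet m n} (Connected CAdj) N →
  Decidable {A = VSet m k} (Connected CAdj)
Connected-decidable {n = n} k≤n count x =
  Dec.map (⇔.sym (Connected-iso (pad-isomorphism 0 k≤n x)))
          (HasCard⇒Decidable VSet-≟ count (pad 0 n x))

-- Counting connected sets by width and offset

ConnectedMeetsAll : ∀ {m k} → VSet m k → Set
ConnectedMeetsAll x = Connected CAdj x × MeetsAllColumns x

count-ConnectedMeetsAll : ∀ {m k c c′} → Decidable {A = VSet m k} (Connected CAdj) →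
  HasCard {VSet m k} InCmk c → HasCard {VSet m k} InC'mk c′ → HasCard ConnectedMeetsAll (c ∸ c′)
count-ConnectedMeetsAll connected? count count′ =
  HasCard-cong (λ x → InCmk∖InC'mk⇔ (connected? x))
               (HasCard-∖ VSet-≟ (λ (cK , _ , meets) → cK , meets) count count′)
  where
  InCmk∖InC'mk⇔ : ∀ {x} → Dec (Connected CAdj x) → (InCmk x × ¬ InC'mk x) ⇔ ConnectedMeetsAll x
  InCmk∖InC'mk⇔ (yes cC) = mk⇔ (λ ((_ , meets) , _) → cC , meets)
                              (λ (cC , meets) → (Connected-CAdj⇒KAdj cC , meets) ,
                                                λ (_ , ¬cC , _) → ¬cC cC)
  InCmk∖InC'mk⇔ (no ¬cC) = mk⇔ (λ ((cK , meets) , ¬c′) → ⊥-elim (¬c′ (cK , ¬cC , meets)))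
                              (λ (cC , _) → ⊥-elim (¬cC cC))

count-Spans : ∀ {m k a n d} → a + k ≤ n → HasCard {VSet m k} ConnectedMeetsAll d →
  HasCard {VSet m n} (λ S → Connected CAdj S × Spans S a k) d
count-Spans {m} {k} {a} {n} a+k≤n count =
  HasCard-cong (λ _ → mk⇔ into onto) (HasCard-image (pad a n) (pad-injective a+k≤n) count)
  where
  into : ∀ {S : VSet m n} → ∃[ x ] ConnectedMeetsAll x × pad a n x ≡ S → Connected CAdj S × Spans S a k
  into (x , (cx , meets) , padx≡S) = subst (λ S → Connected CAdj S × Spans S a k) padx≡S
    ( to (Connected-iso (pad-isomorphism a a+k≤n x)) cx
    , Spans-pad x a+k≤n (to (MeetsAllColumns⇔ x) meets))
  onto : ∀ {S : VSet m n} → Connected CAdj S × Spans S a k → ∃[ x ] ConnectedMeetsAll x × pad a n x ≡ S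
  onto {S} (cS , spans) = R , (cR , from (MeetsAllColumns⇔ R) meets) , padR≡S
    where
    R = restrict a k S
    padR≡S = pad-restrict S a+k≤n spans
    cR : Connected CAdj R
    cR = from (Connected-iso (pad-isomorphism a a+k≤n R)) (subst (Connected CAdj) (sym padR≡S) cS)
    meets : ∀ {t} → t < k → Occupied R t
    meets {t} t<k with from (spans (a + t)) (m≤m+n a t , +-monoʳ-< a t<k)
    ... | i , Sit = i , trans (cell-restrict a k S i t<k) Sit

widths : ℕ → List ℕ
widths n = applyUpTo suc n

offsets : ℕ → ℕ → List ℕ
offsets n k = upTo (n ∸ k + 1)

∈-widths : ∀ {n k} → k ∈ widths n ⇔ (1 ≤ k × k ≤ n)
∈-widths = mk⇔ into onto
  where
  into : ∀ {n k} → k ∈ widths n → 1 ≤ k × k ≤ n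
  into k∈ with ∈-applyUpTo⁻ suc k∈
  ... | _ , i<n , refl = s≤s z≤n , i<n
  onto : ∀ {n k} → 1 ≤ k × k ≤ n → k ∈ widths n
  onto {k = suc i} (_ , i<n) = ∈-applyUpTo⁺ suc i<n

∈-offsets : ∀ {n k a} → k ≤ n → a ∈ offsets n k ⇔ a + k ≤ n
∈-offsets {n} {k} {a} k≤n = mk⇔
  (λ a∈ → m≤o∸n⇒m+n≤o a k≤n (s≤s⁻¹ (subst (a <_) (+-comm (n ∸ k) 1) (∈-upTo⁻ a∈))))
  (λ a+k≤n → ∈-upTo⁺ (subst (a <_) (+-comm 1 (n ∸ k)) (s≤s (m+n≤o⇒m≤o∸n a a+k≤n))))

ConnectedOfWidth : ∀ {m} n → ℕ → VSet m n → Set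
ConnectedOfWidth n k S = ∃[ a ] a ∈ offsets n k × (Connected CAdj S × Spans S a k)

count-width : ∀ {m n k d} → 1 ≤ k → k ≤ n → HasCard {VSet m k} ConnectedMeetsAll d →
  HasCard {VSet m n} (ConnectedOfWidth n k) (d * (n ∸ k + 1))
count-width {n = n} {k} {d} 1≤k k≤n count =
  subst (HasCard _) sum≡ (HasCard-⋃ (λ _ → d) (offsets n k) (upTo⁺ _)
    (λ {x = S} _ _ (_ , spans) (_ , spans′) → proj₁ (Spans-injective S 1≤k 1≤k spans spans′))
    (λ a∈ → count-Spans (to (∈-offsets k≤n) a∈) count))
  where
  sum≡ : sum (map (λ _ → d) (offsets n k)) ≡ d * (n ∸ k + 1)
  sum≡ = begin
    sum (map (λ _ → d) (offsets n k)) ≡⟨ sum-map-const d (offsets n k) ⟩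
    length (offsets n k) * d          ≡⟨ cong (_* d) (length-upTo (n ∸ k + 1)) ⟩
    (n ∸ k + 1) * d                   ≡⟨ *-comm (n ∸ k + 1) d ⟩
    d * (n ∸ k + 1)                   ∎
    where open ≡-Reasoning

count-Connected : ∀ {m n} (d : ℕ → ℕ) →
  (∀ k → 1 ≤ k → k ≤ n → HasCard {VSet m k} ConnectedMeetsAll (d k)) →
  HasCard {VSet m n} (Connected CAdj) (Σ1to n λ k → d k * (n ∸ k + 1))
count-Connected {m} {n} d count = HasCard-cong (λ _ → mk⇔ connected decompose)
  (HasCard-⋃ (λ k → d k * (n ∸ k + 1)) (widths n)
    (applyUpTo⁺₁ suc n λ i<j _ → <⇒≢ i<j ∘ suc-injective)
    (λ {x = S} k∈ k′∈ (_ , _ , _ , spans) (_ , _ , _ , spans′) →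
      proj₂ (Spans-injective S (proj₁ (to ∈-widths k∈)) (proj₁ (to ∈-widths k′∈)) spans spans′))
    λ k∈ → let (1≤k , k≤n) = to ∈-widths k∈ in count-width 1≤k k≤n (count _ 1≤k k≤n))
  where
  connected : ∀ {S : VSet m n} → ∃[ k ] k ∈ widths n × ConnectedOfWidth n k S → Connected CAdj S
  connected (_ , _ , _ , _ , cS , _) = cS
  decompose : ∀ {S : VSet m n} → Connected CAdj S → ∃[ k ] k ∈ widths n × ConnectedOfWidth n k S
  decompose cS with Connected⇒Spans cS
  ... | a , k , 1≤k , a+k≤n , spans =
    k , from ∈-widths (1≤k , k≤n) , a , from (∈-offsets k≤n) a+k≤n , cS , spans
    where
    k≤n : k ≤ n
    k≤n = ≤-trans (m≤n+m k a) a+k≤n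

theorem2p4 : (m n : ℕ) → 1 ≤ m → 1 ≤ n →
    (N : ℕ) → HasCard {VSet m n} (Connected CAdj) N →
    (c c' : ℕ → ℕ) →
    (∀ k → 1 ≤ k → k ≤ n →
      HasCard {VSet m k} InCmk (c k) × HasCard {VSet m k} InC'mk (c' k)) →
    (N ≤ Σ1to n (λ k → (c k ∸ c' k) * (n ∸ k + 1)))
    × (m ≤ 7 → N ≡ Σ1to n (λ k → (c k ∸ c' k) * (n ∸ k + 1)))
theorem2p4 m n _ _ N countN c c' countC = ≤-reflexive N≡ , λ _ → N≡
  where
  countMeetsAll : ∀ k → 1 ≤ k → k ≤ n → HasCard {VSet m k} ConnectedMeetsAll (c k ∸ c' k)
  countMeetsAll k 1≤k k≤n =
    let (countC₁ , countC₂) = countC k 1≤k k≤n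
    in count-ConnectedMeetsAll (Connected-decidable k≤n countN) countC₁ countC₂
  N≡ : N ≡ Σ1to n (λ k → (c k ∸ c' k) * (n ∸ k + 1))
  N≡ = HasCard-unique countN (count-Connected (λ k → c k ∸ c' k) countMeetsAll)
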